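{- Let $\rho\ge1$, $d=(\rho+2)k+1$, and let $(D,T,k)$ be a YES-instance of SFAST with a regular order $\sigma=(v_1,\dots,v_n)$ of $V(D)$ satisfying $\mathrm{cost}(\sigma)\le\rho k$. Let $I=[v_l,v_r]$ be a maximal non-terminal interval w.r.t. $\sigma$ with $|I|\ge 2d+1$, and $I_L=[v_1,v_{l-1}]$, $I_R=[v_{r+1},v_n]$. Then in every optimal order $\sigma^*$ of $V(D)$: every rich or in-rich vertex of $I$ lies to the right of every terminal in $I_L$; and every rich or out-rich vertex of $I$ lies to the left of every terminal in $I_R$.
   Context: SFAST instance $(D,T,k)$: $D$ a tournament, $T\subseteq V(D)$; YES-instance if some $S\subseteq A(D)$, $|S|\le k$, makes $D-S$ free of directed cycles through vertices of $T$. For an order $\sigma=(v_1,\dots,v_n)$: interval $[v_a,v_b]=\{v_m:a\le m\le b\}$, length $b-a+1$; non-terminal interval: contains no vertex of $T$; maximal: not a proper subinterval of another non-terminal interval. An arc $v_av_b$ is backward if $b<a$, its span is $[v_b,v_a]$ and it is above each vertex of its span; affected if above some terminal; $\mathrm{cost}(\sigma)$ = number of affected arcs. An optimal order is one of minimum cost. $\sigma$ is regular if for every non-terminal interval $I=[v_a,v_b]$, $|N^+_I(v_a)|\ge\lceil(b-a)/2\rceil$ and $|N^-_I(v_b)|\ge\lceil(b-a)/2\rceil$ ($N^\pm_X$: out-/in-neighbours within $X$). For a non-terminal $v$ in a maximal non-terminal interval $I$ (w.r.t. $\sigma$): in-rich if $|N^+_I(v)|\le d-1$; out-rich if $|N^-_I(v)|\le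 d-1$; rich if $|N^+_I(v)|\ge d$ and $|N^-_I(v)|\ge d$. -}

module Defs where

open import Data.Nat using (ℕ; _+_; _*_; _∸_; _≤_; _<_; _≤ᵇ_; _<ᵇ_; ⌈_/2⌉)
open import Data.Bool using (Bool; true; false; not; _∧_)
open import Data.Fin using (Fin; toℕ)
open import Data.Fin.Permutation using (Permutation′; _⟨$⟩ʳ_; _⟨$⟩ˡ_)
open import Data.List using (List; []; _∷_; length; filterᵇ; allFin; cartesianProduct)
open import Data.Bool.ListAction using (any)
open import Data.List.Relation.Unary.Unique.Propositional using (Unique)
open import Data.List.Relation.Unary.All using (All)
open import Data.List.Relation.Unary.Any using (Any)
open import Data.List.Membership.Propositional using (_∉_)
open import Data.Product using (Σ; _×_; _,_; ∃-syntax)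
open import Data.Sum using (_⊎_)
open import Relation.Binary.PropositionalEquality using (_≡_; _≢_)
open import Relation.Nullary using (¬_)

record Tournament (n : ℕ) : Set where
  field
    arc    : Fin n → Fin n → Bool
    irrefl : ∀ v → arc v v ≡ false
    tourn  : ∀ u v → u ≢ v → arc u v ≡ not (arc v u)
open Tournament public

TermSet : ℕ → Set
TermSet n = Fin n → Bool

countV : ∀ {n} → (Fin n → Bool) → ℕ
countV {n} p = length (filterᵇ p (allFin n))

countP : ∀ {n} → (Fin n × Fin n → Bool) → ℕ
countP {n} p = length (filterᵇ p (cartesianProduct (allFin n) (allFin n)))

ArcMinus : ∀ {n} → Tournament n → List (Fin n × Fin n) → Fin n → Fin n → Set
ArcMinus D S u v = (arc D u v ≡ true) × ((u , v) ∉ S)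

Walk : ∀ {n} → Tournament n → List (Fin n × Fin n) → Fin n → List (Fin n) → Fin n → Set
Walk D S x []       y = ArcMinus D S x y
Walk D S x (z ∷ zs) y = ArcMinus D S x z × Walk D S z zs y

CycleThroughTerminal : ∀ {n} → Tournament n → TermSet n → List (Fin n × Fin n) → Set
CycleThroughTerminal {n} D T S =
  Σ (Fin n) λ x → Σ (List (Fin n)) λ zs →
    Unique (x ∷ zs) × Walk D S x zs x × Any (λ v → T v ≡ true) (x ∷ zs)

YesInstance : ∀ {n} → Tournament n → TermSet n → ℕ → Set
YesInstance {n} D T k =
  Σ (List (Fin n × Fin n)) λ S →
    Unique S × All (λ e → arc D (Data.Product.proj₁ e) (Data.Product.proj₂ e) ≡ true) S
    × length S ≤ k × ¬ CycleThroughTerminal D T S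

-- Orders: σ ⟨$⟩ʳ i is the vertex at position i, σ ⟨$⟩ˡ v the position of v.

Order : ℕ → Set
Order n = Permutation′ n

pos : ∀ {n} → Order n → Fin n → ℕ
pos σ v = toℕ (σ ⟨$⟩ˡ v)

affected : ∀ {n} → Tournament n → TermSet n → Order n → Fin n × Fin n → Bool
affected {n} D T σ (u , v) =
  arc D u v ∧ (pos σ v <ᵇ pos σ u)
  ∧ any (λ t → T t ∧ (pos σ v ≤ᵇ pos σ t) ∧ (pos σ t ≤ᵇ pos σ u)) (allFin n)

cost : ∀ {n} → Tournament n → TermSet n → Order n → ℕ
cost D T σ = countP (affected D T σ)

Optimal : ∀ {n} → Tournament n → TermSet n → Order n → Set
Optimal {n} D T σ = ∀ (τ : Order n) → cost D T σ ≤ cost D T τ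

-- Intervals, given by positions a ≤ b (0-based)

inI : ∀ {n} → Order n → ℕ → ℕ → Fin n → Bool
inI σ a b v = (a ≤ᵇ pos σ v) ∧ (pos σ v ≤ᵇ b)

NonTerminalInterval : ∀ {n} → TermSet n → Order n → Fin n → Fin n → Set
NonTerminalInterval T σ a b =
  (toℕ a ≤ toℕ b) × (∀ v → inI σ (toℕ a) (toℕ b) v ≡ true → T v ≡ false)

MaximalNonTerminalInterval : ∀ {n} → TermSet n → Order n → Fin n → Fin n → Set
MaximalNonTerminalInterval T σ l r =
  NonTerminalInterval T σ l r ×
  (∀ a b → NonTerminalInterval T σ a b → toℕ a ≤ toℕ l → toℕ r ≤ toℕ b →
     (a ≡ l) × (b ≡ r))

outDegI : ∀ {n} → Tournament n → Order n → ℕ → ℕ → Fin n → ℕ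
outDegI D σ a b x = countV (λ u → inI σ a b u ∧ arc D x u)

inDegI : ∀ {n} → Tournament n → Order n → ℕ → ℕ → Fin n → ℕ
inDegI D σ a b x = countV (λ u → inI σ a b u ∧ arc D u x)

Regular : ∀ {n} → Tournament n → TermSet n → Order n → Set
Regular D T σ =
  ∀ a b → NonTerminalInterval T σ a b →
    (⌈ (toℕ b ∸ toℕ a) /2⌉ ≤ outDegI D σ (toℕ a) (toℕ b) (σ ⟨$⟩ʳ a)) ×
    (⌈ (toℕ b ∸ toℕ a) /2⌉ ≤ inDegI D σ (toℕ a) (toℕ b) (σ ⟨$⟩ʳ b))

InIntervalNT : ∀ {n} → TermSet n → Order n → Fin n → Fin n → Fin n → Set
InIntervalNT T σ l r v = (inI σ (toℕ l) (toℕ r) v ≡ true) × (T v ≡ false)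

InRich : ∀ {n} → Tournament n → Order n → Fin n → Fin n → ℕ → Fin n → Set
InRich D σ l r d v = outDegI D σ (toℕ l) (toℕ r) v ≤ d ∸ 1

OutRich : ∀ {n} → Tournament n → Order n → Fin n → Fin n → ℕ → Fin n → Set
OutRich D σ l r d v = inDegI D σ (toℕ l) (toℕ r) v ≤ d ∸ 1

Rich : ∀ {n} → Tournament n → Order n → Fin n → Fin n → ℕ → Fin n → Set
Rich D σ l r d v = (d ≤ outDegI D σ (toℕ l) (toℕ r) v) × (d ≤ inDegI D σ (toℕ l) (toℕ r) v)

-- An optimal order costs at most k. For a solution S, the digraph D − S has no cycle through a
-- terminal, so ordering the vertices by 2 · (number of their ancestors in D − S), plus 1 for
-- non-terminals, leaves no arc of D − S pointing backward over a terminal: every affected arc of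
-- that order lies in S.
-- Now let t be a terminal left of I and v a rich or in-rich vertex; since |I| ≥ 2d + 1, v has at
-- least d in-neighbours u in I. An arc u → t would be affected in σ, so at most ρk of them send one;
-- all others satisfy t → u → v. If v did not follow t in σ*, each of these u would give an affected
-- arc of σ* (t → u if u precedes t, u → v otherwise), and there are d − ρk > k of them,
-- more than σ* costs. Terminals right of I are handled symmetrically.

module Submission where

open import Defs
open import Data.Bool using (Bool; true; false; not; _∧_; if_then_else_) renaming (T to IsTrue)
open import Data.Bool.Properties using (T-≡; T-∧; ∧-conicalˡ; ∧-conicalʳ) renaming (_≟_ to _≟ᵇ_)
open import Data.Empty using (⊥)
import Data.Fin as Fin
open import Data.Fin using (Fin; toℕ; fromℕ<; punchOut)
open import Data.Fin.Permutation using (permutation; _⟨$⟩ʳ_; _⟨$⟩ˡ_; inverseˡ; inverseʳ)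
open import Data.Fin.Properties
  using (toℕ-injective; toℕ-fromℕ<; toℕ<n; injective⇒≤; punchOut-injective; any?)
  renaming (_≟_ to _≟ᶠ_)
open import Data.List using (List; []; _∷_; [_]; _++_; length; filterᵇ; allFin; lookup)
open import Data.List.Properties using (length-++; length-tabulate)
open import Data.List.Membership.Propositional using (_∈_; lose)
open import Data.List.Membership.Propositional.Properties
  using (∈-filter⁺; ∈-filter⁻; ∈-allFin; ∈-cartesianProduct⁺; ∈-lookup; ∈-++⁺ˡ; ∈-++⁺ʳ)
import Data.List.Membership.DecPropositional as DecMembership
open import Data.List.Relation.Unary.All as All using ([]; _∷_)
open import Data.List.Relation.Unary.All.Properties using (¬Any⇒All¬)
open import Data.List.Relation.Unary.Any as Any using (here; there)
open import Data.List.Relation.Unary.Any.Properties using (lookup-index; any⁺; any⁻)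
open import Data.List.Relation.Unary.Unique.Propositional using (Unique; []; _∷_)
open import Data.List.Relation.Unary.Unique.Propositional.Properties
  using (filter⁺; allFin⁺; cartesianProduct⁺)
open import Data.Nat using (ℕ; zero; suc; _+_; _*_; _∸_; _≤_; _<_; _<ᵇ_; z≤n; s≤s; z<s)
open import Data.Nat.Properties
open import Data.Product using (Σ; ∃; ∃-syntax; _×_; _,_; proj₁; proj₂; swap)
open import Data.Product.Properties using (≡-dec)
open import Data.Sum using (_⊎_; inj₁; inj₂; map₁)
open import Function using (_∘_; id)
open import Function.Bundles using (Equivalence)
open import Relation.Binary.Definitions using (tri<; tri≈; tri>)
open import Relation.Binary.PropositionalEquality
  using (_≡_; _≢_; refl; sym; trans; cong; cong₂; subst; subst₂; module ≡-Reasoning)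
open import Relation.Nullary using (¬_; Dec; yes; no; does; contradiction; ¬?; _×-dec_; _⊎-dec_)
open import Relation.Nullary.Decidable using (T?; dec-true; dec-false; decidable-stable)

private
  variable
    A B : Set
    n : ℕ

IsTrue⇒≡true : ∀ {b} → IsTrue b → b ≡ true
IsTrue⇒≡true = Equivalence.to T-≡

≡true⇒IsTrue : ∀ {b} → b ≡ true → IsTrue b
≡true⇒IsTrue = Equivalence.from T-≡

does≡true⇒ : ∀ {P : Set} (P? : Dec P) → does P? ≡ true → P
does≡true⇒ (yes p) _ = p

¬IsTrue⇒≡false : ∀ {b} → ¬ IsTrue b → b ≡ false
¬IsTrue⇒≡false {false} _   = refl
¬IsTrue⇒≡false {true}  ¬tt = contradiction _ ¬tt

Unique-lookup-injective : ∀ {xs : List A} → Unique xs → ∀ i j → lookup xs i ≡ lookup xs j → i ≡ j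
Unique-lookup-injective (x∉xs ∷ u) Fin.zero    Fin.zero    _  = refl
Unique-lookup-injective (x∉xs ∷ u) Fin.zero    (Fin.suc j) eq = contradiction eq (All.lookup x∉xs (∈-lookup j))
Unique-lookup-injective (x∉xs ∷ u) (Fin.suc i) Fin.zero    eq = contradiction (sym eq) (All.lookup x∉xs (∈-lookup i))
Unique-lookup-injective (x∉xs ∷ u) (Fin.suc i) (Fin.suc j) eq = cong Fin.suc (Unique-lookup-injective u i j eq)

injectiveOn⇒length≤ : ∀ {xs : List A} {ys : List B} (g : A → B) → Unique xs →
  (∀ {x} → x ∈ xs → g x ∈ ys) → (∀ {x y} → x ∈ xs → y ∈ xs → g x ≡ g y → x ≡ y) →
  length xs ≤ length ys
injectiveOn⇒length≤ {xs = xs} {ys} g u into inj = injective⇒≤ index-injective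
  where
  index : Fin (length xs) → Fin (length ys)
  index i = Any.index (into (∈-lookup i))

  index-injective : ∀ {i j} → index i ≡ index j → i ≡ j
  index-injective {i} {j} eq = Unique-lookup-injective u i j (inj (∈-lookup i) (∈-lookup j) (begin
    g (lookup xs i)      ≡⟨ lookup-index (into (∈-lookup i)) ⟩
    lookup ys (index i)  ≡⟨ cong (lookup ys) eq ⟩
    lookup ys (index j)  ≡⟨ lookup-index (into (∈-lookup j)) ⟨
    g (lookup xs j)      ∎))
    where open ≡-Reasoning

∈-filterᵇ⁺ : ∀ (p : A → Bool) {x xs} → x ∈ xs → p x ≡ true → x ∈ filterᵇ p xs
∈-filterᵇ⁺ p x∈xs px = ∈-filter⁺ (T? ∘ p) x∈xs (≡true⇒IsTrue px)

∈-filterᵇ⁻ : ∀ (p : A → Bool) {x} xs → x ∈ filterᵇ p xs → p x ≡ true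
∈-filterᵇ⁻ p xs x∈ = IsTrue⇒≡true (proj₂ (∈-filter⁻ (T? ∘ p) {xs = xs} x∈))

length-filterᵇ≤ : ∀ (p : A → Bool) {xs : List A} {ys : List B} (g : A → B) → Unique xs →
  (∀ x → p x ≡ true → g x ∈ ys) →
  (∀ x y → p x ≡ true → p y ≡ true → g x ≡ g y → x ≡ y) →
  length (filterᵇ p xs) ≤ length ys
length-filterᵇ≤ p {xs} g u into inj = injectiveOn⇒length≤ g (filter⁺ (T? ∘ p) u)
  (λ {x} x∈ → into x (∈-filterᵇ⁻ p xs x∈))
  (λ {x} {y} x∈ y∈ → inj x y (∈-filterᵇ⁻ p xs x∈) (∈-filterᵇ⁻ p xs y∈))

Unique⇒length≤ : ∀ {n} {xs : List (Fin n)} → Unique xs → length xs ≤ n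
Unique⇒length≤ {n} {xs} u = subst (length xs ≤_) (length-tabulate {n = n} id)
  (injectiveOn⇒length≤ id u (λ {x} _ → ∈-allFin x) (λ _ _ → id))

module _ {n : ℕ} where

  countV-cover : ∀ (p : Fin n → Bool) {ys} → (∀ x → p x ≡ true → x ∈ ys) → countV p ≤ length ys
  countV-cover p into = length-filterᵇ≤ p id (allFin⁺ n) into (λ _ _ _ _ → id)

  suc-countV-cover : ∀ (p : Fin n → Bool) {x ys} → p x ≡ false →
    (∀ y → p y ≡ true ⊎ y ≡ x → y ∈ ys) → suc (countV p) ≤ length ys
  suc-countV-cover p {x} {ys} px≡false into =
    injectiveOn⇒length≤ id (All.tabulate x≢ ∷ filter⁺ (T? ∘ p) (allFin⁺ n)) into′ (λ _ _ → id)
    where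
    x≢ : ∀ {y} → y ∈ filterᵇ p (allFin n) → x ≢ y
    x≢ y∈ refl = contradiction (trans (sym px≡false) (∈-filterᵇ⁻ p (allFin n) y∈)) λ ()

    into′ : ∀ {y} → y ∈ x ∷ filterᵇ p (allFin n) → y ∈ ys
    into′ (here refl) = into x (inj₂ refl)
    into′ (there y∈)  = into _ (inj₁ (∈-filterᵇ⁻ p (allFin n) y∈))

  countV-mono : ∀ (p q : Fin n → Bool) → (∀ x → p x ≡ true → q x ≡ true) → countV p ≤ countV q
  countV-mono p q p⊆q = countV-cover p (λ x px → ∈-filterᵇ⁺ q (∈-allFin x) (p⊆q x px))

  countV-strict : ∀ (p q : Fin n → Bool) {x} → (∀ y → p y ≡ true → q y ≡ true) →
    p x ≡ false → q x ≡ true → countV p < countV q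
  countV-strict p q {x} p⊆q px qx = suc-countV-cover p px into
    where
    into : ∀ y → p y ≡ true ⊎ y ≡ x → y ∈ filterᵇ q (allFin n)
    into y (inj₁ py)   = ∈-filterᵇ⁺ q (∈-allFin y) (p⊆q y py)
    into y (inj₂ refl) = ∈-filterᵇ⁺ q (∈-allFin y) qx

  countV-< : ∀ (p : Fin n → Bool) {x} → p x ≡ false → countV p < n
  countV-< p px = subst (suc (countV p) ≤_) (length-tabulate id)
    (suc-countV-cover p px (λ y _ → ∈-allFin y))

  countV-split : ∀ (p q r : Fin n → Bool) → (∀ x → p x ≡ true → q x ≡ true ⊎ r x ≡ true) →
    countV p ≤ countV q + countV r
  countV-split p q r cover = subst (countV p ≤_) (length-++ (filterᵇ q (allFin n)))
    (countV-cover p into)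
    where
    into : ∀ x → p x ≡ true → x ∈ filterᵇ q (allFin n) ++ filterᵇ r (allFin n)
    into x px with cover x px
    ... | inj₁ qx = ∈-++⁺ˡ (∈-filterᵇ⁺ q (∈-allFin x) qx)
    ... | inj₂ rx = ∈-++⁺ʳ (filterᵇ q (allFin n)) (∈-filterᵇ⁺ r (∈-allFin x) rx)

  injection⇒≤countV : ∀ {m} (p : Fin n → Bool) (g : Fin m → Fin n) →
    (∀ {i j} → g i ≡ g j → i ≡ j) → (∀ i → p (g i) ≡ true) → m ≤ countV p
  injection⇒≤countV {m} p g g-inj pg = subst (_≤ countV p) (length-tabulate id)
    (injectiveOn⇒length≤ g (allFin⁺ m) (λ {i} _ → ∈-filterᵇ⁺ p (∈-allFin (g i)) (pg i)) (λ _ _ → g-inj))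

  injectiveOn⇒countV≤countP : ∀ (p : Fin n → Bool) (q : Fin n × Fin n → Bool) (g : Fin n → Fin n × Fin n) →
    (∀ x → p x ≡ true → q (g x) ≡ true) →
    (∀ x y → p x ≡ true → p y ≡ true → g x ≡ g y → x ≡ y) → countV p ≤ countP q
  injectiveOn⇒countV≤countP p q g pq inj = length-filterᵇ≤ p g (allFin⁺ n)
    (λ x px → ∈-filterᵇ⁺ q (∈-cartesianProduct⁺ (∈-allFin _) (∈-allFin _)) (pq x px)) inj

  countP-cover : ∀ (q : Fin n × Fin n → Bool) {ys} → (∀ e → q e ≡ true → e ∈ ys) → countP q ≤ length ys
  countP-cover q into = length-filterᵇ≤ q id (cartesianProduct⁺ (allFin⁺ n) (allFin⁺ n)) into (λ _ _ _ _ → id)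

injective⇒surjective : ∀ (f : Fin n → Fin n) → (∀ {x y} → f x ≡ f y → x ≡ y) → ∀ i → ∃ λ x → f x ≡ i
injective⇒surjective {suc m} f f-inj i with any? (λ x → f x ≟ᶠ i)
... | yes hit = hit
... | no miss = contradiction (injective⇒≤ punched-injective) (1+n≰n {m})
  where
  punched : Fin (suc m) → Fin m
  punched x = punchOut {i = i} (λ i≡fx → miss (x , sym i≡fx))

  punched-injective : ∀ {x y} → punched x ≡ punched y → x ≡ y
  punched-injective eq = f-inj (punchOut-injective {i = i} _ _ eq)

orderWithPositions : ∀ (f : Fin n → Fin n) → (∀ {x y} → f x ≡ f y → x ≡ y) → Order n
orderWithPositions f f-inj = permutation vertexAt f (λ x → f-inj (proj₂ (surj (f x)))) (λ i → proj₂ (surj i))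
  where
  surj : ∀ i → ∃ λ x → f x ≡ i
  surj = injective⇒surjective f f-inj

  vertexAt : Fin _ → Fin _
  vertexAt i = proj₁ (surj i)

-- Ties between equal keys are broken by the vertex index, so the rank is injective.
sortingOrder : ∀ (key : Fin n → ℕ) → Σ (Order n) λ τ → ∀ x y → pos τ x ≤ pos τ y → key x ≤ key y
sortingOrder {n} key = τ , key-monotone
  where
  rank : Fin n → ℕ
  rank x = key x * n + toℕ x

  rank-mono : ∀ {x y} → key x < key y → rank x < rank y
  rank-mono {x} {y} kx<ky = begin-strict
    key x * n + toℕ x   <⟨ +-monoʳ-< (key x * n) (toℕ<n x) ⟩
    key x * n + n       ≡⟨ +-comm (key x * n) n ⟩
    suc (key x) * n     ≤⟨ *-monoˡ-≤ n kx<ky ⟩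
    key y * n           ≤⟨ m≤m+n (key y * n) (toℕ y) ⟩
    key y * n + toℕ y   ∎
    where open ≤-Reasoning

  rank-injective : ∀ {x y} → rank x ≡ rank y → x ≡ y
  rank-injective {x} {y} eq with <-cmp (key x) (key y)
  ... | tri< kx<ky _ _ = contradiction eq (<⇒≢ (rank-mono kx<ky))
  ... | tri> _ _ ky<kx = contradiction (sym eq) (<⇒≢ (rank-mono ky<kx))
  ... | tri≈ _ kx≡ky _ = toℕ-injective (+-cancelˡ-≡ (key x * n) _ _
                            (trans eq (cong (λ k → k * n + toℕ y) (sym kx≡ky))))

  rank<ᵇrank≡false : ∀ x → (rank x <ᵇ rank x) ≡ false
  rank<ᵇrank≡false x = ¬IsTrue⇒≡false (n≮n (rank x) ∘ <ᵇ⇒< _ _)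

  position : Fin n → ℕ
  position x = countV (λ y → rank y <ᵇ rank x)

  position-mono : ∀ {x y} → rank x < rank y → position x < position y
  position-mono {x} {y} rx<ry = countV-strict (λ z → rank z <ᵇ rank x) (λ z → rank z <ᵇ rank y) {x}
    (λ z rz<rx → IsTrue⇒≡true (<⇒<ᵇ (<-trans (<ᵇ⇒< _ _ (≡true⇒IsTrue rz<rx)) rx<ry)))
    (rank<ᵇrank≡false x) (IsTrue⇒≡true (<⇒<ᵇ rx<ry))

  position-injective : ∀ {x y} → position x ≡ position y → x ≡ y
  position-injective {x} {y} eq with <-cmp (rank x) (rank y)
  ... | tri< rx<ry _ _ = contradiction eq (<⇒≢ (position-mono rx<ry))
  ... | tri≈ _ rx≡ry _ = rank-injective rx≡ry
  ... | tri> _ _ ry<rx = contradiction (sym eq) (<⇒≢ (position-mono ry<rx))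

  position<n : ∀ x → position x < n
  position<n x = countV-< (λ z → rank z <ᵇ rank x) {x} (rank<ᵇrank≡false x)

  τ : Order n
  τ = orderWithPositions (λ x → fromℕ< (position<n x))
        (λ {x} {y} eq → position-injective (trans (sym (toℕ-fromℕ< _)) (trans (cong toℕ eq) (toℕ-fromℕ< _))))

  key-monotone : ∀ x y → pos τ x ≤ pos τ y → key x ≤ key y
  key-monotone x y px≤py = ≮⇒≥ λ ky<kx → ≤⇒≯ (subst₂ _≤_ (toℕ-fromℕ< _) (toℕ-fromℕ< _) px≤py)
                                               (position-mono (rank-mono ky<kx))

<∸⇒+< : ∀ {a j c} → j < c ∸ a → a + j < c
<∸⇒+< {a} {j} {c} j<c∸a = begin-strict
  a + j        <⟨ +-monoʳ-< a j<c∸a ⟩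
  a + (c ∸ a)  ≡⟨ m+[n∸m]≡n (<⇒≤ (m∸n≢0⇒n<m {c} {a} λ c∸a≡0 → n≮0 (subst (j <_) c∸a≡0 j<c∸a))) ⟩
  c            ∎
  where open ≤-Reasoning

module _ {n} (σ : Order n) where

  inI-intro : ∀ {a b u} → a ≤ pos σ u → pos σ u ≤ b → inI σ a b u ≡ true
  inI-intro a≤u u≤b = cong₂ _∧_ (IsTrue⇒≡true (≤⇒≤ᵇ a≤u)) (IsTrue⇒≡true (≤⇒≤ᵇ u≤b))

  inI-elim : ∀ {a b u} → inI σ a b u ≡ true → a ≤ pos σ u × pos σ u ≤ b
  inI-elim u∈I =
    ≤ᵇ⇒≤ _ _ (≡true⇒IsTrue (∧-conicalˡ _ _ u∈I)) , ≤ᵇ⇒≤ _ _ (≡true⇒IsTrue (∧-conicalʳ _ _ u∈I))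

  b+1∸a≤countV-inI : ∀ a b → b < n → b + 1 ∸ a ≤ countV (inI σ a b)
  b+1∸a≤countV-inI a b b<n = injection⇒≤countV (inI σ a b) vertexAt vertexAt-injective vertexAt∈I
    where
    offset≤b : ∀ (j : Fin (b + 1 ∸ a)) → a + toℕ j ≤ b
    offset≤b j = m<1+n⇒m≤n (subst (a + toℕ j <_) (+-comm b 1) (<∸⇒+< (toℕ<n j)))

    offset<n : ∀ (j : Fin (b + 1 ∸ a)) → a + toℕ j < n
    offset<n j = ≤-<-trans (offset≤b j) b<n

    vertexAt : Fin (b + 1 ∸ a) → Fin n
    vertexAt j = σ ⟨$⟩ʳ fromℕ< (offset<n j)

    pos-vertexAt : ∀ j → pos σ (vertexAt j) ≡ a + toℕ j
    pos-vertexAt j = trans (cong toℕ (inverseˡ σ)) (toℕ-fromℕ< (offset<n j))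

    vertexAt-injective : ∀ {i j} → vertexAt i ≡ vertexAt j → i ≡ j
    vertexAt-injective {i} {j} eq = toℕ-injective (+-cancelˡ-≡ a _ _
      (trans (sym (pos-vertexAt i)) (trans (cong (pos σ) eq) (pos-vertexAt j))))

    vertexAt∈I : ∀ j → inI σ a b (vertexAt j) ≡ true
    vertexAt∈I j = inI-intro (subst (a ≤_) (sym (pos-vertexAt j)) (m≤m+n a (toℕ j)))
      (subst (_≤ b) (sym (pos-vertexAt j)) (offset≤b j))

  pos-injective : ∀ {x y} → pos σ x ≡ pos σ y → x ≡ y
  pos-injective {x} {y} eq = begin
    x                       ≡⟨ inverseʳ σ ⟨
    σ ⟨$⟩ʳ (σ ⟨$⟩ˡ x)        ≡⟨ cong (σ ⟨$⟩ʳ_) (toℕ-injective eq) ⟩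
    σ ⟨$⟩ʳ (σ ⟨$⟩ˡ y)        ≡⟨ inverseʳ σ ⟩
    y                       ∎
    where open ≡-Reasoning

module _ {n} (D : Tournament n) (T : TermSet n) (σ : Order n) where

  affected-intro : ∀ {u v} t → arc D u v ≡ true → pos σ v < pos σ u → T t ≡ true →
    pos σ v ≤ pos σ t → pos σ t ≤ pos σ u → affected D T σ (u , v) ≡ true
  affected-intro t uv v<u tt v≤t t≤u = IsTrue⇒≡true (∧⁺ (≡true⇒IsTrue uv) (∧⁺ (<⇒<ᵇ v<u)
    (any⁺ _ (lose (∈-allFin t) (∧⁺ (≡true⇒IsTrue tt) (∧⁺ (≤⇒≤ᵇ v≤t) (≤⇒≤ᵇ t≤u)))))))
    where
    ∧⁺ : ∀ {a b} → IsTrue a → IsTrue b → IsTrue (a ∧ b)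
    ∧⁺ ta tb = Equivalence.from T-∧ (ta , tb)

  affected-elim : ∀ {u v} → affected D T σ (u , v) ≡ true →
    arc D u v ≡ true × pos σ v < pos σ u × ∃[ t ] T t ≡ true × pos σ v ≤ pos σ t × pos σ t ≤ pos σ u
  affected-elim {u} {v} aff
    with uv , rest ← Equivalence.to T-∧ (≡true⇒IsTrue aff)
    with v<u , some ← Equivalence.to T-∧ rest
    with t , span ← Any.satisfied (any⁻ _ (allFin n) some)
    with tt , bounds ← Equivalence.to T-∧ span
    with v≤t , t≤u ← Equivalence.to T-∧ bounds
    = IsTrue⇒≡true uv , <ᵇ⇒< _ _ v<u , t , IsTrue⇒≡true tt , ≤ᵇ⇒≤ _ _ v≤t , ≤ᵇ⇒≤ _ _ t≤u

-- Reachability in D − S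

module _ {n} (D : Tournament n) where

  arc⇒≢ : ∀ {u v} → arc D u v ≡ true → u ≢ v
  arc⇒≢ {u} uv refl = contradiction (trans (sym uv) (irrefl D u)) λ ()

  arc-or-reverse : ∀ {u v} → u ≢ v → arc D u v ≡ true ⊎ arc D v u ≡ true
  arc-or-reverse {u} {v} u≢v with arc D u v in uv
  ... | true  = inj₁ refl
  ... | false = inj₂ (trans (tourn D v u (u≢v ∘ sym)) (cong not uv))

module Reachability {n} (D : Tournament n) (S : List (Fin n × Fin n)) where
  open DecMembership (≡-dec (_≟ᶠ_ {n}) (_≟ᶠ_ {n})) using () renaming (_∈?_ to _∈ˢ?_)
  open DecMembership (_≟ᶠ_ {n}) using (_∈?_)

  arcMinus? : ∀ u v → Dec (ArcMinus D S u v)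
  arcMinus? u v = (arc D u v ≟ᵇ true) ×-dec ¬? ((u , v) ∈ˢ? S)

  loop-free : ∀ {x} → ¬ ArcMinus D S x x
  loop-free (xx , _) = arc⇒≢ D xx refl

  Reach : ℕ → Fin n → Fin n → Set
  Reach zero    y x = y ≡ x
  Reach (suc m) y x = y ≡ x ⊎ ∃[ z ] ArcMinus D S y z × Reach m z x

  reach? : ∀ m y x → Dec (Reach m y x)
  reach? zero    y x = y ≟ᶠ x
  reach? (suc m) y x = y ≟ᶠ x ⊎-dec any? (λ z → arcMinus? y z ×-dec reach? m z x)

  reach-refl : ∀ m x → Reach m x x
  reach-refl zero    x = refl
  reach-refl (suc m) x = inj₁ refl

  reach⇒walk : ∀ m {y x} → Reach m y x → y ≡ x ⊎ ∃[ zs ] Walk D S y zs x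
  reach⇒walk zero    y≡x        = inj₁ y≡x
  reach⇒walk (suc m) (inj₁ y≡x) = inj₁ y≡x
  reach⇒walk (suc m) (inj₂ (z , yz , zx)) with reach⇒walk m zx
  ... | inj₁ refl     = inj₂ ([] , yz)
  ... | inj₂ (zs , w) = inj₂ (z ∷ zs , yz , w)

  walk⇒reach : ∀ {m y} zs {x} → Walk D S y zs x → length zs < m → Reach m y x
  walk⇒reach {suc m} []       {x} yx       _         = inj₂ (x , yx , reach-refl m x)
  walk⇒reach {suc m} (z ∷ zs)     (yz , w) (s≤s len) = inj₂ (z , yz , walk⇒reach zs w len)

  walk-snoc : ∀ {y} zs {a b} → Walk D S y zs a → ArcMinus D S a b → Walk D S y (zs ++ [ a ]) b
  walk-snoc []       ya       ab = ya , ab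
  walk-snoc (z ∷ zs) (yz , w) ab = yz , walk-snoc zs w ab

  -- A path from y to x through ps is a walk with Unique (x ∷ y ∷ ps).
  suffixPath : ∀ {y u} ws {x} → y ∈ u ∷ ws → Walk D S u ws x → Unique (x ∷ u ∷ ws) →
    ∃[ vs ] Walk D S y vs x × Unique (x ∷ y ∷ vs)
  suffixPath ws       (here refl) w        U = ws , w , U
  suffixPath (v ∷ ws) (there y∈)  (_ , w)  ((_ ∷ x∉) ∷ (_ ∷ U)) = suffixPath ws y∈ w (x∉ ∷ U)

  walk⇒path : ∀ {y} zs {x} → Walk D S y zs x → y ≢ x → ∃[ ps ] Walk D S y ps x × Unique (x ∷ y ∷ ps)
  walk⇒path []       yx y≢x = [] , yx , ((y≢x ∘ sym) ∷ []) ∷ [] ∷ []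
  walk⇒path {y} (z ∷ zs) {x} (yz , w) y≢x with z ≟ᶠ x
  ... | yes refl = [] , yz , ((y≢x ∘ sym) ∷ []) ∷ [] ∷ []
  ... | no z≢x with walk⇒path zs w z≢x
  ...   | ps , w′ , U@(x∉ ∷ U′) with y ∈? z ∷ ps
  ...     | yes y∈ = suffixPath ps y∈ w′ U
  ...     | no  y∉ = z ∷ ps , (yz , w′) , ((y≢x ∘ sym) ∷ x∉) ∷ ¬Any⇒All¬ _ y∉ ∷ U′

  reach-step : ∀ {y a b} → Reach n y a → ArcMinus D S a b → Reach n y b
  reach-step {y} {a} {b} ya ab with reach⇒walk n ya
  ... | inj₁ refl = walk⇒reach [] ab (≤-<-trans z≤n (toℕ<n y))
  ... | inj₂ (zs , w) with y ≟ᶠ b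
  ...   | yes refl = reach-refl n y
  ...   | no y≢b with walk⇒path (zs ++ [ a ]) (walk-snoc zs w ab) y≢b
  ...     | ps , w′ , U = walk⇒reach ps w′ (≤-trans (n≤1+n _) (Unique⇒length≤ U))

  module _ (T : TermSet n) (acyclic : ¬ CycleThroughTerminal D T S) where

    closedWalk-avoids-terminals : ∀ {a} zs → T a ≡ true → ¬ Walk D S a zs a
    closedWalk-avoids-terminals []       _  aa       = loop-free aa
    closedWalk-avoids-terminals (z ∷ zs) ta (az , w) with walk⇒path zs w (λ { refl → loop-free az })
    ... | ps , w′ , U = acyclic (_ , z ∷ ps , U , (az , w′) , here ta)

    no-return-through-terminal : ∀ {u v} → ArcMinus D S u v → T u ≡ true ⊎ T v ≡ true → ¬ Reach n v u
    no-return-through-terminal uv tu⊎tv vu with reach⇒walk n vu | tu⊎tv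
    ... | inj₁ refl     | _       = loop-free uv
    ... | inj₂ (zs , w) | inj₁ tu = closedWalk-avoids-terminals (_ ∷ zs) tu (uv , w)
    ... | inj₂ (zs , w) | inj₂ tv = closedWalk-avoids-terminals (zs ++ [ _ ]) tv (walk-snoc zs w uv)

    #ancestors : Fin n → ℕ
    #ancestors x = countV (λ y → does (reach? n y x))

    ancestor-step : ∀ {u v} → ArcMinus D S u v → ∀ y → does (reach? n y u) ≡ true → does (reach? n y v) ≡ true
    ancestor-step {u} {v} uv y yu = dec-true (reach? n y v) (reach-step (does≡true⇒ (reach? n y u) yu) uv)

    #ancestors-mono : ∀ {u v} → ArcMinus D S u v → #ancestors u ≤ #ancestors v
    #ancestors-mono uv = countV-mono _ _ (ancestor-step uv)

    #ancestors-strict : ∀ {u v} → ArcMinus D S u v → T u ≡ true ⊎ T v ≡ true → #ancestors u < #ancestors v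
    #ancestors-strict {u} {v} uv tu⊎tv = countV-strict _ _ {v} (ancestor-step uv)
      (dec-false (reach? n v u) (no-return-through-terminal uv tu⊎tv))
      (dec-true (reach? n v v) (reach-refl n v))

-- A backward arc u → v over a terminal t forces key v ≤ key t ≤ key u; the size conditions rule this
-- out unless u and v are non-terminals of equal size, and then the parities of the keys do.
module ParityKey {n} (T : TermSet n) (E : Fin n → Fin n → Set) (size : Fin n → ℕ)
  (size-mono : ∀ {u v} → E u v → size u ≤ size v)
  (size-strict : ∀ {u v} → E u v → T u ≡ true ⊎ T v ≡ true → size u < size v) where

  parityKey : Fin n → ℕ
  parityKey x = 2 * size x + (if T x then 0 else 1)

  parityKey-terminal : ∀ {x} → T x ≡ true → parityKey x ≡ 2 * size x
  parityKey-terminal tx rewrite tx = +-identityʳ _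

  parityKey-nonterminal : ∀ {x} → T x ≡ false → parityKey x ≡ suc (2 * size x)
  parityKey-nonterminal tx rewrite tx = +-comm _ 1

  no-backward-arc-over-terminal : (p : Fin n → ℕ) → (∀ x y → p x ≤ p y → parityKey x ≤ parityKey y) →
    ∀ {u v t} → E u v → p v < p u → T t ≡ true → p v ≤ p t → p t ≤ p u → ⊥
  no-backward-arc-over-terminal p key-mono {u} {v} {t} uv vu tt vt tu with T u in T-u | T v in T-v
  ... | true | _ = <⇒≱ (begin-strict
    parityKey u   ≡⟨ parityKey-terminal T-u ⟩
    2 * size u    <⟨ *-monoʳ-< 2 (size-strict uv (inj₁ T-u)) ⟩
    2 * size v    ≤⟨ m≤m+n _ _ ⟩
    parityKey v   ∎) (key-mono v u (<⇒≤ vu))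
    where open ≤-Reasoning
  ... | false | true = <⇒≱ (begin-strict
    parityKey u              ≡⟨ parityKey-nonterminal T-u ⟩
    suc (2 * size u)         <⟨ n<1+n _ ⟩
    suc (suc (2 * size u))   ≡⟨ *-suc 2 (size u) ⟨
    2 * suc (size u)         ≤⟨ *-monoʳ-≤ 2 (size-strict uv (inj₂ T-v)) ⟩
    2 * size v               ≡⟨ parityKey-terminal T-v ⟨
    parityKey v              ∎) (key-mono v u (<⇒≤ vu))
    where open ≤-Reasoning
  ... | false | false = even≢odd (size t) (size v) (≤-antisym t≤v v<t)
    where
    t≤v : 2 * size t ≤ suc (2 * size v)
    t≤v = begin
      2 * size t         ≡⟨ parityKey-terminal tt ⟨
      parityKey t        ≤⟨ key-mono t u tu ⟩
      parityKey u        ≡⟨ parityKey-nonterminal T-u ⟩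
      suc (2 * size u)   ≤⟨ s≤s (*-monoʳ-≤ 2 (size-mono uv)) ⟩
      suc (2 * size v)   ∎
      where open ≤-Reasoning
    v<t : suc (2 * size v) ≤ 2 * size t
    v<t = begin
      suc (2 * size v)   ≡⟨ parityKey-nonterminal T-v ⟨
      parityKey v        ≤⟨ key-mono v t vt ⟩
      parityKey t        ≡⟨ parityKey-terminal tt ⟩
      2 * size t         ∎
      where open ≤-Reasoning

-- Optimal orders cost at most k

module _ {n} (D : Tournament n) (T : TermSet n) (S : List (Fin n × Fin n)) where
  open DecMembership (≡-dec (_≟ᶠ_ {n}) (_≟ᶠ_ {n})) using (_∈?_)

  Safe : Order n → Set
  Safe τ = ∀ {u v t} → ArcMinus D S u v → pos τ v < pos τ u →
    T t ≡ true → pos τ v ≤ pos τ t → pos τ t ≤ pos τ u → ⊥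

  safe⇒cost≤length : (τ : Order n) → Safe τ → cost D T τ ≤ length S
  safe⇒cost≤length τ safe = countP-cover _ λ (u , v) aff →
    let uv , v<u , t , tt , v≤t , t≤u = affected-elim D T τ aff
    in decidable-stable ((u , v) ∈? S) λ uv∉S → safe (uv , uv∉S) v<u tt v≤t t≤u

  noTerminalCycle⇒safeOrder : ¬ CycleThroughTerminal D T S → Σ (Order n) Safe
  noTerminalCycle⇒safeOrder acyclic =
    let τ , key-mono = sortingOrder parityKey in τ , no-backward-arc-over-terminal (pos τ) key-mono
    where
    open Reachability D S
    open ParityKey T (ArcMinus D S) (#ancestors T acyclic) (#ancestors-mono T acyclic) (#ancestors-strict T acyclic)

optimal⇒cost≤k : ∀ {n k} (D : Tournament n) (T : TermSet n) → YesInstance D T k →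
  (σ* : Order n) → Optimal D T σ* → cost D T σ* ≤ k
optimal⇒cost≤k D T (S , _ , _ , |S|≤k , acyclic) σ* optimal =
  let τ , safe = noTerminalCycle⇒safeOrder D T S acyclic
  in ≤-trans (optimal τ) (≤-trans (safe⇒cost≤length D T S τ safe) |S|≤k)

-- Degrees and affected arcs around an interval

module _ {n} (D : Tournament n) where

  countV-inI≤inDegI+outDegI : ∀ σ a b v →
    countV (inI σ a b) ≤ inDegI D σ a b v + outDegI D σ a b v + 1
  countV-inI≤inDegI+outDegI σ a b v = subst (countV (inI σ a b) ≤_) length-parts (countV-cover _ into)
    where
    inN outN : Fin n → Bool
    inN  u = inI σ a b u ∧ arc D u v
    outN u = inI σ a b u ∧ arc D v u

    parts : List (Fin n)
    parts = filterᵇ inN (allFin n) ++ filterᵇ outN (allFin n) ++ [ v ]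

    length-parts : length parts ≡ inDegI D σ a b v + outDegI D σ a b v + 1
    length-parts = begin
      length parts
        ≡⟨ length-++ (filterᵇ inN (allFin n)) ⟩
      inDegI D σ a b v + length (filterᵇ outN (allFin n) ++ [ v ])
        ≡⟨ cong (inDegI D σ a b v +_) (length-++ (filterᵇ outN (allFin n))) ⟩
      inDegI D σ a b v + (outDegI D σ a b v + 1)
        ≡⟨ +-assoc (inDegI D σ a b v) _ 1 ⟨
      inDegI D σ a b v + outDegI D σ a b v + 1 ∎
      where open ≡-Reasoning

    into : ∀ u → inI σ a b u ≡ true → u ∈ parts
    into u u∈I with u ≟ᶠ v
    ... | yes refl = ∈-++⁺ʳ (filterᵇ inN (allFin n)) (∈-++⁺ʳ (filterᵇ outN (allFin n)) (here refl))
    ... | no u≢v with arc-or-reverse D u≢v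
    ...   | inj₁ uv = ∈-++⁺ˡ (∈-filterᵇ⁺ inN (∈-allFin u) (cong₂ _∧_ u∈I uv))
    ...   | inj₂ vu = ∈-++⁺ʳ (filterᵇ inN (allFin n)) (∈-++⁺ˡ (∈-filterᵇ⁺ outN (∈-allFin u) (cong₂ _∧_ u∈I vu)))

  richOrInRich⇒d≤inDegI : ∀ σ l r d v → 2 * d + 1 ≤ countV (inI σ (toℕ l) (toℕ r)) →
    Rich D σ l r d v ⊎ InRich D σ l r d v → d ≤ inDegI D σ (toℕ l) (toℕ r) v
  richOrInRich⇒d≤inDegI σ l r d v |I|≥ (inj₁ (_ , d≤in)) = d≤in
  richOrInRich⇒d≤inDegI σ l r d v |I|≥ (inj₂ out≤d∸1) = +-cancelʳ-≤ d d in′ (+-cancelʳ-≤ 1 _ _ (begin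
    d + d + 1                                 ≡⟨ cong (λ m → d + m + 1) (+-identityʳ d) ⟨
    2 * d + 1                                 ≤⟨ |I|≥ ⟩
    countV (inI σ (toℕ l) (toℕ r))            ≤⟨ countV-inI≤inDegI+outDegI σ (toℕ l) (toℕ r) v ⟩
    in′ + outDegI D σ (toℕ l) (toℕ r) v + 1   ≤⟨ +-monoˡ-≤ 1 (+-monoʳ-≤ in′ (≤-trans out≤d∸1 (m∸n≤m d 1))) ⟩
    in′ + d + 1                               ∎))
    where
    open ≤-Reasoning
    in′ : ℕ
    in′ = inDegI D σ (toℕ l) (toℕ r) v

converse : ∀ {n} → Tournament n → Tournament n
converse D = record
  { arc    = λ u v → arc D v u
  ; irrefl = irrefl D
  ; tourn  = λ u v u≢v → tourn D v u (u≢v ∘ sym)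
  }

-- Reversing every arc swaps in- and out-degrees, definitionally.
richOrOutRich⇒d≤outDegI : ∀ {n} (D : Tournament n) σ l r d v → 2 * d + 1 ≤ countV (inI σ (toℕ l) (toℕ r)) →
  Rich D σ l r d v ⊎ OutRich D σ l r d v → d ≤ outDegI D σ (toℕ l) (toℕ r) v
richOrOutRich⇒d≤outDegI D σ l r d v |I|≥ rich =
  richOrInRich⇒d≤inDegI (converse D) σ l r d v |I|≥ (map₁ swap rich)

module _ {n} (D : Tournament n) (T : TermSet n) (σ : Order n) where

  arcsIntoEarlierTerminal≤cost : ∀ {a b t} → T t ≡ true → pos σ t < a →
    countV (λ u → inI σ a b u ∧ arc D u t) ≤ cost D T σ
  arcsIntoEarlierTerminal≤cost {a} {b} {t} tt t<a = injectiveOn⇒countV≤countP _ _ (λ u → u , t) isAffected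
    (λ _ _ _ _ → cong proj₁)
    where
    isAffected : ∀ u → inI σ a b u ∧ arc D u t ≡ true → affected D T σ (u , t) ≡ true
    isAffected u h = affected-intro D T σ t (∧-conicalʳ (inI σ a b u) _ h) t<u tt ≤-refl (<⇒≤ t<u)
      where
      t<u : pos σ t < pos σ u
      t<u = <-≤-trans t<a (proj₁ (inI-elim σ {a} {b} (∧-conicalˡ (inI σ a b u) _ h)))

  arcsFromLaterTerminal≤cost : ∀ {a b t} → T t ≡ true → b < pos σ t →
    countV (λ u → inI σ a b u ∧ arc D t u) ≤ cost D T σ
  arcsFromLaterTerminal≤cost {a} {b} {t} tt b<t = injectiveOn⇒countV≤countP _ _ (λ u → t , u) isAffected
    (λ _ _ _ _ → cong proj₂)
    where
    isAffected : ∀ u → inI σ a b u ∧ arc D t u ≡ true → affected D T σ (t , u) ≡ true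
    isAffected u h = affected-intro D T σ t (∧-conicalʳ (inI σ a b u) _ h) u<t tt (<⇒≤ u<t) ≤-refl
      where
      u<t : pos σ u < pos σ t
      u<t = ≤-<-trans (proj₂ (inI-elim σ {a} (∧-conicalˡ (inI σ a b u) _ h))) b<t

  -- Each u with t → u → v yields an affected arc: t → u if u precedes t, otherwise u → v.
  twoPathsFromTerminal≤cost : ∀ {t v} → T t ≡ true → pos σ v ≤ pos σ t →
    countV (λ u → arc D u v ∧ arc D t u) ≤ cost D T σ
  twoPathsFromTerminal≤cost {t} {v} tt v≤t = injectiveOn⇒countV≤countP _ _ witness isAffected injective
    where
    witness : Fin n → Fin n × Fin n
    witness u with pos σ u <? pos σ t
    ... | yes _ = t , u
    ... | no  _ = u , v

    t<u : ∀ {u} → arc D t u ≡ true → ¬ pos σ u < pos σ t → pos σ t < pos σ u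
    t<u tu u≮t = ≤∧≢⇒< (≮⇒≥ u≮t) (arc⇒≢ D tu ∘ pos-injective σ)

    isAffected : ∀ u → arc D u v ∧ arc D t u ≡ true → affected D T σ (witness u) ≡ true
    isAffected u h with pos σ u <? pos σ t
    ... | yes u<t = affected-intro D T σ t (∧-conicalʳ (arc D u v) _ h) u<t tt (<⇒≤ u<t) ≤-refl
    ... | no  u≮t = affected-intro D T σ t (∧-conicalˡ (arc D u v) _ h)
                      (≤-<-trans v≤t (t<u (∧-conicalʳ (arc D u v) _ h) u≮t)) tt v≤t
                      (<⇒≤ (t<u (∧-conicalʳ (arc D u v) _ h) u≮t))

    injective : ∀ u u′ → arc D u v ∧ arc D t u ≡ true → arc D u′ v ∧ arc D t u′ ≡ true →
      witness u ≡ witness u′ → u ≡ u′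
    injective u u′ h h′ eq with pos σ u <? pos σ t | pos σ u′ <? pos σ t
    ... | yes _ | yes _ = cong proj₂ eq
    ... | no  _ | no  _ = cong proj₁ eq
    ... | yes _ | no  _ = contradiction (cong proj₁ eq) (arc⇒≢ D (∧-conicalʳ (arc D u′ v) _ h′))
    ... | no  _ | yes _ = contradiction (sym (cong proj₁ eq)) (arc⇒≢ D (∧-conicalʳ (arc D u v) _ h))

  twoPathsToTerminal≤cost : ∀ {t v} → T t ≡ true → pos σ t ≤ pos σ v →
    countV (λ u → arc D v u ∧ arc D u t) ≤ cost D T σ
  twoPathsToTerminal≤cost {t} {v} tt t≤v = injectiveOn⇒countV≤countP _ _ witness isAffected injective
    where
    witness : Fin n → Fin n × Fin n
    witness u with pos σ t <? pos σ u
    ... | yes _ = u , t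
    ... | no  _ = v , u

    u<t : ∀ {u} → arc D u t ≡ true → ¬ pos σ t < pos σ u → pos σ u < pos σ t
    u<t ut t≮u = ≤∧≢⇒< (≮⇒≥ t≮u) (arc⇒≢ D ut ∘ pos-injective σ)

    isAffected : ∀ u → arc D v u ∧ arc D u t ≡ true → affected D T σ (witness u) ≡ true
    isAffected u h with pos σ t <? pos σ u
    ... | yes t<u = affected-intro D T σ t (∧-conicalʳ (arc D v u) _ h) t<u tt ≤-refl (<⇒≤ t<u)
    ... | no  t≮u = affected-intro D T σ t (∧-conicalˡ (arc D v u) _ h)
                      (<-≤-trans (u<t (∧-conicalʳ (arc D v u) _ h) t≮u) t≤v) tt
                      (<⇒≤ (u<t (∧-conicalʳ (arc D v u) _ h) t≮u)) t≤v

    injective : ∀ u u′ → arc D v u ∧ arc D u t ≡ true → arc D v u′ ∧ arc D u′ t ≡ true →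
      witness u ≡ witness u′ → u ≡ u′
    injective u u′ h h′ eq with pos σ t <? pos σ u | pos σ t <? pos σ u′
    ... | yes _ | yes _ = cong proj₁ eq
    ... | no  _ | no  _ = cong proj₂ eq
    ... | yes _ | no  _ = contradiction (sym (cong proj₂ eq)) (arc⇒≢ D (∧-conicalʳ (arc D v u′) _ h′))
    ... | no  _ | yes _ = contradiction (cong proj₂ eq) (arc⇒≢ D (∧-conicalʳ (arc D v u) _ h))

module _ {n} (D : Tournament n) (T : TermSet n) (σ σ* : Order n) {a b : ℕ}
  (I-nonterminal : ∀ u → inI σ a b u ≡ true → T u ≡ false) where

  private
    I-avoids : ∀ {u t} → inI σ a b u ≡ true → T t ≡ true → u ≢ t
    I-avoids u∈I tt refl = contradiction (trans (sym tt) (I-nonterminal _ u∈I)) λ ()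

  terminalLeftOfI-precedes : ∀ {v t} → T t ≡ true → pos σ t < a →
    cost D T σ + cost D T σ* < inDegI D σ a b v → pos σ* t < pos σ* v
  terminalLeftOfI-precedes {v} {t} tt t<a heavy =
    decidable-stable (pos σ* t <? pos σ* v) λ t≮v → <⇒≱ heavy (begin
      inDegI D σ a b v
        ≤⟨ countV-split _ _ _ split ⟩
      countV (λ u → arc D u v ∧ arc D t u) + countV (λ u → inI σ a b u ∧ arc D u t)
        ≤⟨ +-mono-≤ (twoPathsFromTerminal≤cost D T σ* tt (≮⇒≥ t≮v)) (arcsIntoEarlierTerminal≤cost D T σ {b = b} tt t<a) ⟩
      cost D T σ* + cost D T σ
        ≡⟨ +-comm (cost D T σ*) _ ⟩
      cost D T σ + cost D T σ* ∎)
    where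
    open ≤-Reasoning
    split : ∀ u → inI σ a b u ∧ arc D u v ≡ true → arc D u v ∧ arc D t u ≡ true ⊎ inI σ a b u ∧ arc D u t ≡ true
    split u h with arc-or-reverse D (I-avoids (∧-conicalˡ (inI σ a b u) _ h) tt)
    ... | inj₁ ut = inj₂ (cong₂ _∧_ (∧-conicalˡ (inI σ a b u) _ h) ut)
    ... | inj₂ tu = inj₁ (cong₂ _∧_ (∧-conicalʳ (inI σ a b u) _ h) tu)

  terminalRightOfI-succeeds : ∀ {v t} → T t ≡ true → b < pos σ t →
    cost D T σ + cost D T σ* < outDegI D σ a b v → pos σ* v < pos σ* t
  terminalRightOfI-succeeds {v} {t} tt b<t heavy =
    decidable-stable (pos σ* v <? pos σ* t) λ v≮t → <⇒≱ heavy (begin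
      outDegI D σ a b v
        ≤⟨ countV-split _ _ _ split ⟩
      countV (λ u → arc D v u ∧ arc D u t) + countV (λ u → inI σ a b u ∧ arc D t u)
        ≤⟨ +-mono-≤ (twoPathsToTerminal≤cost D T σ* tt (≮⇒≥ v≮t)) (arcsFromLaterTerminal≤cost D T σ {a} tt b<t) ⟩
      cost D T σ* + cost D T σ
        ≡⟨ +-comm (cost D T σ*) _ ⟩
      cost D T σ + cost D T σ* ∎)
    where
    open ≤-Reasoning
    split : ∀ u → inI σ a b u ∧ arc D v u ≡ true → arc D v u ∧ arc D u t ≡ true ⊎ inI σ a b u ∧ arc D t u ≡ true
    split u h with arc-or-reverse D (I-avoids (∧-conicalˡ (inI σ a b u) _ h) tt)
    ... | inj₁ ut = inj₁ (cong₂ _∧_ (∧-conicalʳ (inI σ a b u) _ h) ut)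
    ... | inj₂ tu = inj₂ (cong₂ _∧_ (∧-conicalˡ (inI σ a b u) _ h) tu)

ρk+k<[ρ+2]k+1 : ∀ ρ k → ρ * k + k < (ρ + 2) * k + 1
ρk+k<[ρ+2]k+1 ρ k = begin-strict
  ρ * k + k           ≤⟨ +-monoʳ-≤ (ρ * k) (m≤m+n k (k + 0)) ⟩
  ρ * k + 2 * k       ≡⟨ *-distribʳ-+ k ρ 2 ⟨
  (ρ + 2) * k         <⟨ m<m+n _ z<s ⟩
  (ρ + 2) * k + 1     ∎
  where open ≤-Reasoning

lemma7 : ∀ {n} (ρ k : ℕ) → 1 ≤ ρ →
    (D : Tournament n) (T : TermSet n) → YesInstance D T k →
    (σ : Order n) → Regular D T σ → cost D T σ ≤ ρ * k →
    (l r : Fin n) → MaximalNonTerminalInterval T σ l r →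
    2 * ((ρ + 2) * k + 1) + 1 ≤ toℕ r + 1 ∸ toℕ l →
    (σ* : Order n) → Optimal D T σ* →
    (∀ v t → InIntervalNT T σ l r v →
       (Rich D σ l r ((ρ + 2) * k + 1) v ⊎ InRich D σ l r ((ρ + 2) * k + 1) v) →
       T t ≡ true → pos σ t < toℕ l → pos σ* t < pos σ* v) ×
    (∀ v t → InIntervalNT T σ l r v →
       (Rich D σ l r ((ρ + 2) * k + 1) v ⊎ OutRich D σ l r ((ρ + 2) * k + 1) v) →
       T t ≡ true → toℕ r < pos σ t → pos σ* v < pos σ* t)
lemma7 ρ k _ D T yesInstance σ _ cost-σ l r ((_ , I-nonterminal) , _) long σ* optimal =
  (λ v t _ rich tt t<l → terminalLeftOfI-precedes D T σ σ* {toℕ l} {toℕ r} I-nonterminal tt t<l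
      (<-≤-trans costs<d (richOrInRich⇒d≤inDegI D σ l r d v |I|≥2d+1 rich))) ,
  (λ v t _ rich tt r<t → terminalRightOfI-succeeds D T σ σ* {toℕ l} {toℕ r} I-nonterminal tt r<t
      (<-≤-trans costs<d (richOrOutRich⇒d≤outDegI D σ l r d v |I|≥2d+1 rich)))
  where
  d : ℕ
  d = (ρ + 2) * k + 1

  |I|≥2d+1 : 2 * d + 1 ≤ countV (inI σ (toℕ l) (toℕ r))
  |I|≥2d+1 = ≤-trans long (b+1∸a≤countV-inI σ (toℕ l) (toℕ r) (toℕ<n r))

  costs<d : cost D T σ + cost D T σ* < d
  costs<d = ≤-<-trans (+-mono-≤ cost-σ (optimal⇒cost≤k D T yesInstance σ* optimal)) (ρk+k<[ρ+2]k+1 ρ k)
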